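{- Let $\mathcal{P}=(N,\preccurlyeq)$ be a finite poset with $N=\{1,\dots,n\}$. Let $G_1=(U,V;E_1)$ be the bipartite graph with $U=\{u_1,\dots,u_n\}$, $V=\{v_1,\dots,v_n\}$ and $E_1=\{\{u_i,v_j\} : j\prec i \text{ in } \mathcal{P}\}$, and let $w_1\colon E_1\to\mathbb{Z}_{\ge0}$ be given by \[ w_1(\{u_i,v_j\})=\max\{\, |S|-1 : S\subseteq N \text{ is a chain with } j\preccurlyeq s\preccurlyeq i \text{ for all } s\in S\,\}. \] Define $f_1\colon 2^N\to\mathbb{R}$ by \[ f_1(X)=\max\{\, w_1(M) : M\subseteq E_1 \text{ is a matching with } \partial M\subseteq U_X\cup V_{\overline{X}} \,\}, \] where $w_1(M)=\sum_{e\in M}w_1(e)$, $U_X=\{u_i: i\in X\}$ and $V_{\overline{X}}=\{v_i : i\notin X\}$. Then $f_1$ is $\mathrm{M}^\natural$-concave, and for every $X\subseteq N$, $f_1(X)=0$ if $X\in\mathcal{I}(\mathcal{P})$ and $f_1(X)>0$ otherwise.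
   Context: $j\prec i$ means $j\preccurlyeq i$ and $j\ne i$. A chain is a subset totally ordered by $\preccurlyeq$. A matching is a set $M$ of edges no two of which share an endpoint (the empty set included); $\partial M$ denotes the set of vertices incident to some edge of $M$. An ideal of $\mathcal{P}$ is a subset $I\subseteq N$ with $x\preccurlyeq y\in I\Rightarrow x\in I$; $\mathcal{I}(\mathcal{P})$ is the set of all ideals. A set function $f\colon 2^N\to\mathbb{R}$ is $\mathrm{M}^\natural$-concave if for all $X,Y\subseteq N$ and every $i\in X\setminus Y$, either $f(X)+f(Y)\le f(X\setminus\{i\})+f(Y\cup\{i\})$, or there exists $j\in Y\setminus X$ with $f(X)+f(Y)\le f((X\setminus\{i\})\cup\{j\})+f((Y\cup\{i\})\setminus\{j\})$. -}

module Defs where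

open import Level using (0ℓ)
open import Data.Bool using (Bool; true; false; if_then_else_)
open import Data.Nat using (ℕ; zero; suc; _+_; _∸_; _⊔_; _≤_; _<_)
open import Data.Nat.ListAction using (sum)
open import Data.Fin using (Fin; _≟_)
open import Data.Fin.Properties using (all?)
open import Data.Fin.Subset using (Subset; _∈_; _∉_; _∪_; _-_; ⁅_⁆; ∣_∣)
open import Data.Fin.Subset.Properties using (_∈?_)
open import Data.List using (List; []; _∷_; map; filter; concatMap; allFin)
open import Data.Vec using (Vec; []; _∷_; lookup)
open import Data.Product using (_×_; ∃-syntax)
open import Data.Sum using (_⊎_)
open import Relation.Nullary using (¬_; Dec)
open import Relation.Nullary.Decidable using (_×-dec_; _⊎-dec_; _→-dec_; ¬?)
open import Relation.Binary using (Rel; Decidable)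
open import Relation.Binary.PropositionalEquality using (_≡_; _≢_)

-- maximum of g over a finite list (0 for the empty list; every use below
-- ranges over a list containing an element of value 0, so this is the true max)
maxOver : {A : Set} → List A → (A → ℕ) → ℕ
maxOver []       g = 0
maxOver (a ∷ as) g = g a ⊔ maxOver as g

vecsOf : {A : Set} → List A → (m : ℕ) → List (Vec A m)
vecsOf xs zero    = [] ∷ []
vecsOf xs (suc m) = concatMap (λ x → map (x ∷_) (vecsOf xs m)) xs

allSubsets : (n : ℕ) → List (Subset n)
allSubsets n = vecsOf (true ∷ false ∷ []) n

MNatConcave : {n : ℕ} → (Subset n → ℕ) → Set
MNatConcave {n} f =
  ∀ (X Y : Subset n) (i : Fin n) → i ∈ X → i ∉ Y →
    (f X + f Y ≤ f (X - i) + f (Y ∪ ⁅ i ⁆))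
    ⊎ (∃[ j ] (j ∈ Y × j ∉ X ×
         f X + f Y ≤ f ((X - i) ∪ ⁅ j ⁆) + f ((Y ∪ ⁅ i ⁆) - j)))

module PosetDefs {n : ℕ} (_≼_ : Rel (Fin n) 0ℓ) (_≼?_ : Decidable _≼_) where

  _≺_ : Rel (Fin n) 0ℓ
  j ≺ i = j ≼ i × j ≢ i

  _≺?_ : Decidable _≺_
  j ≺? i = (j ≼? i) ×-dec ¬? (j ≟ i)

  IsChain : Subset n → Set
  IsChain S = ∀ s t → s ∈ S → t ∈ S → (s ≼ t ⊎ t ≼ s)

  isChain? : (S : Subset n) → Dec (IsChain S)
  isChain? S = all? λ s → all? λ t →
    (s ∈? S) →-dec ((t ∈? S) →-dec ((s ≼? t) ⊎-dec (t ≼? s)))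

  Between : Fin n → Fin n → Subset n → Set
  Between j i S = ∀ s → s ∈ S → (j ≼ s × s ≼ i)

  between? : ∀ j i (S : Subset n) → Dec (Between j i S)
  between? j i S = all? λ s → (s ∈? S) →-dec ((j ≼? s) ×-dec (s ≼? i))

  -- w₁({u_i, v_j}) = max { |S| - 1 : S chain, j ≼ s ≼ i for all s ∈ S }
  -- (defined for all pairs; only used on edges j ≺ i, where {i} is such a chain)
  w₁ : Fin n → Fin n → ℕ
  w₁ i j = maxOver (filter (λ S → isChain? S ×-dec between? j i S) (allSubsets n))
                   (λ S → ∣ S ∣ ∸ 1)

  -- A set of pairs (u_i, v_j), encoded as an n×n Boolean matrix:
  -- the pair {u_i, v_j} is in M iff  lookup (lookup M i) j ≡ true, i.e. j ∈ lookup M i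
  EdgeSet : Set
  EdgeSet = Vec (Subset n) n

  allEdgeSets : List EdgeSet
  allEdgeSets = vecsOf (allSubsets n) n

  InM : EdgeSet → Fin n → Fin n → Set
  InM M i j = j ∈ lookup M i

  SubE₁ : EdgeSet → Set
  SubE₁ M = ∀ i j → InM M i j → j ≺ i

  IsMatching : EdgeSet → Set
  IsMatching M = (∀ i j j′ → InM M i j → InM M i j′ → j ≡ j′)
               × (∀ i i′ j → InM M i j → InM M i′ j → i ≡ i′)

  BoundaryOK : Subset n → EdgeSet → Set
  BoundaryOK X M = ∀ i j → InM M i j → (i ∈ X × j ∉ X)

  Admissible : Subset n → EdgeSet → Set
  Admissible X M = SubE₁ M × IsMatching M × BoundaryOK X M

  admissible? : ∀ X M → Dec (Admissible X M)
  admissible? X M =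
    (all? λ i → all? λ j → (j ∈? lookup M i) →-dec (j ≺? i))
    ×-dec ((all? λ i → all? λ j → all? λ j′ →
              (j ∈? lookup M i) →-dec ((j′ ∈? lookup M i) →-dec (j ≟ j′)))
           ×-dec (all? λ i → all? λ i′ → all? λ j →
              (j ∈? lookup M i) →-dec ((j ∈? lookup M i′) →-dec (i ≟ i′))))
    ×-dec (all? λ i → all? λ j →
              (j ∈? lookup M i) →-dec ((i ∈? X) ×-dec ¬? (j ∈? X)))

  weight : EdgeSet → ℕ
  weight M = sum (map (λ i → sum (map (λ j → if lookup (lookup M i) j then w₁ i j else 0)
                                      (allFin n)))
                      (allFin n))

  f₁ : Subset n → ℕ
  f₁ X = maxOver (filter (admissible? X) allEdgeSets) weight

  IsIdeal : Subset n → Set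
  IsIdeal X = ∀ x y → x ≼ y → y ∈ X → x ∈ X

module Submission where

-- f₁(X) is a maximum-weight matching problem, and the exchange property is proved by
-- rearranging optimal matchings M₁ for X and M₂ for Y along the alternating path through
-- i ∈ X ∖ Y: drop the M₁-edge i → a, hang a (or what lies below it) under i or under the
-- M₂-parent of i, and repair a's M₂-side. The weights are superadditive along chains,
-- w₁(i,a) + w₁(a,c) ≤ w₁(i,c), so replacing two consecutive edges by one never loses weight.
-- When the path runs into a vertex b ∈ X ∩ Y the same problem arises for X - i, Y - b at b,
-- which is solved by induction on |X|. If X is an ideal no edge crosses from U_X to V_X̄,
-- so f₁(X) = 0; otherwise a single crossing edge j ≺ i already has positive weight.

open import Defs
open import Level using (0ℓ)
open import Data.Bool using (Bool; true; false; if_then_else_)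
open import Data.Empty using (⊥-elim) renaming (⊥ to Empty)
open import Data.Fin using (Fin; zero; suc; _≟_)
open import Data.Fin.Properties using (any?; all?; ¬∀⟶∃¬)
open import Data.Fin.Subset
  using (Subset; _∈_; _∉_; _∪_; _∩_; _─_; _-_; ⁅_⁆; ∣_∣; ⊥; inside; outside)
open import Data.Fin.Subset.Properties
  using (_∈?_; x∈⁅x⁆; x∈⁅y⁆⇒x≡y; x≢y⇒x∉⁅y⁆; ∣⁅x⁆∣≡1; ∉⊥; x∈p∪q⁻; x∈p∪q⁺; x∈p∩q⁻;
         p⊆q⇒∣p∣≤∣q∣; p⊂q⇒∣p∣<∣q∣; p⊆p∪q; q⊆p∪q; ∣p∣≤∣p∪q∣; ∣q∣≤∣p∪q∣;
         x∈p∧x≢y⇒x∈p-y; x∈p⇒∣p-x∣<∣p∣; ⊆-antisym; Empty-unique)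
open import Data.List using (List; []; _∷_; map; allFin; tabulate)
open import Data.List.Membership.Propositional using () renaming (_∈_ to _∈ₗ_)
open import Data.List.Membership.Propositional.Properties
  using (∈-map⁺; ∈-concatMap⁺; ∈-filter⁻; ∈-filter⁺)
open import Data.List.Properties using (map-tabulate; tabulate-cong)
import Data.List.Relation.Unary.Any as Any
open import Data.Nat using (ℕ; zero; suc; _+_; _∸_; _≤_; _<_)
open import Data.Nat.ListAction using (sum)
open import Data.Nat.Properties hiding (_≟_)
open import Algebra.Properties.CommutativeSemigroup +-commutativeSemigroup using (interchange)
open import Data.Nat.Tactic.RingSolver using (solve-∀)
open import Data.Product using (_×_; _,_; ∃-syntax; proj₁; proj₂; curry)
open import Data.Sum using (_⊎_; inj₁; inj₂; [_,_]′; map₂) renaming (map to ⊎-map)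
open import Data.Vec using (Vec; []; _∷_; here; there; lookup; _[_]≔_; replicate)
open import Data.Vec.Properties using (lookup∘update; lookup∘update′; lookup-replicate)
open import Function using (_∘_)
open import Relation.Binary using (Rel; IsDecPartialOrder)
open import Relation.Binary.PropositionalEquality
open import Relation.Nullary using (¬_; Dec; yes; no; contradiction)
open import Relation.Nullary.Decidable using (_×-dec_; _→-dec_; decidable-stable)

-- Finite maxima, sums and cardinalities

maxOver-upperBound : ∀ {A : Set} {x : A} (xs : List A) (g : A → ℕ) →
                     x ∈ₗ xs → g x ≤ maxOver xs g
maxOver-upperBound (a ∷ xs) g (Any.here refl) = m≤m⊔n (g a) (maxOver xs g)
maxOver-upperBound (a ∷ xs) g (Any.there x∈xs) =
  ≤-trans (maxOver-upperBound xs g x∈xs) (m≤n⊔m (g a) (maxOver xs g))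

maxOver-attained : ∀ {A : Set} {x : A} (xs : List A) (g : A → ℕ) →
                   x ∈ₗ xs → ∃[ y ] (y ∈ₗ xs × maxOver xs g ≡ g y)
maxOver-attained (a ∷ [])     g _ = a , Any.here refl , ⊔-identityʳ (g a)
maxOver-attained (a ∷ b ∷ xs) g _
  with maxOver-attained (b ∷ xs) g (Any.here refl) | ⊔-sel (g a) (maxOver (b ∷ xs) g)
... | _ , _    , _    | inj₁ max≡a = a , Any.here refl , max≡a
... | y , y∈xs , rest≡gy | inj₂ max≡rest = y , Any.there y∈xs , trans max≡rest rest≡gy

∈-vecsOf : ∀ {A : Set} (xs : List A) → (∀ a → a ∈ₗ xs) → ∀ m (v : Vec A m) → v ∈ₗ vecsOf xs m
∈-vecsOf xs every zero    []      = Any.here refl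
∈-vecsOf xs every (suc m) (a ∷ v) =
  ∈-concatMap⁺ (λ x → map (x ∷_) (vecsOf xs m))
    (Any.map (λ { refl → ∈-map⁺ (a ∷_) (∈-vecsOf xs every m v) }) (every a))

∈-allSubsets : ∀ {m} (p : Subset m) → p ∈ₗ allSubsets m
∈-allSubsets {m} = ∈-vecsOf _ every-bool m
  where
  every-bool : ∀ b → b ∈ₗ (true ∷ false ∷ [])
  every-bool true  = Any.here refl
  every-bool false = Any.there (Any.here refl)

sum-tabulate-update : ∀ {m} (g g′ : Fin m → ℕ) (h : Fin m) → (∀ k → k ≢ h → g k ≡ g′ k) →
                      sum (tabulate g′) + g h ≡ sum (tabulate g) + g′ h
sum-tabulate-update {suc m} g g′ zero agree
  rewrite tabulate-cong {f = g′ ∘ suc} {g = g ∘ suc} (λ k → sym (agree (suc k) λ ()))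
  = swap-ends (g′ zero) (sum (tabulate (g ∘ suc))) (g zero)
  where
  swap-ends : ∀ a s b → a + s + b ≡ b + s + a
  swap-ends = solve-∀
sum-tabulate-update {suc m} g g′ (suc h) agree = begin
  g′ zero + sum (tabulate (g′ ∘ suc)) + g (suc h)   ≡⟨ +-assoc (g′ zero) _ _ ⟩
  g′ zero + (sum (tabulate (g′ ∘ suc)) + g (suc h)) ≡⟨ cong₂ _+_ (sym (agree zero λ ())) rest ⟩
  g zero + (sum (tabulate (g ∘ suc)) + g′ (suc h))  ≡⟨ +-assoc (g zero) _ _ ⟨
  g zero + sum (tabulate (g ∘ suc)) + g′ (suc h)    ∎
  where
  open ≡-Reasoning
  rest : sum (tabulate (g′ ∘ suc)) + g (suc h) ≡ sum (tabulate (g ∘ suc)) + g′ (suc h)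
  rest = sum-tabulate-update (g ∘ suc) (g′ ∘ suc) h (λ k k≢h → agree (suc k) λ { refl → k≢h refl })

sum-tabulate-zero : ∀ {m} (g : Fin m → ℕ) → (∀ k → g k ≡ 0) → sum (tabulate g) ≡ 0
sum-tabulate-zero {zero}  g zeros = refl
sum-tabulate-zero {suc m} g zeros rewrite zeros zero = sum-tabulate-zero (g ∘ suc) (zeros ∘ suc)

sum-allFin : ∀ {m} (g : Fin m → ℕ) → sum (map g (allFin m)) ≡ sum (tabulate g)
sum-allFin g = cong sum (map-tabulate (λ x → x) g)

sum-lookup-update : ∀ {m} {A : Set} (f : Fin m → A → ℕ) (v : Vec A m) (h : Fin m) (x : A) →
  sum (map (λ j → f j (lookup (v [ h ]≔ x) j)) (allFin m)) + f h (lookup v h)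
  ≡ sum (map (λ j → f j (lookup v j)) (allFin m)) + f h x
sum-lookup-update f v h x
  rewrite sum-allFin (λ j → f j (lookup (v [ h ]≔ x) j)) | sum-allFin (λ j → f j (lookup v j))
  = trans (sum-tabulate-update (λ j → f j (lookup v j)) (λ j → f j (lookup (v [ h ]≔ x) j)) h
             (λ k k≢h → cong (f k) (sym (lookup∘update′ k≢h v x))))
          (cong (λ y → _ + f h y) (lookup∘update h v x))

∣p∣+∣q∣≡∣p∪q∣+∣p∩q∣ : ∀ {m} (p q : Subset m) → ∣ p ∣ + ∣ q ∣ ≡ ∣ p ∪ q ∣ + ∣ p ∩ q ∣
∣p∣+∣q∣≡∣p∪q∣+∣p∩q∣ []            []            = refl
∣p∣+∣q∣≡∣p∪q∣+∣p∩q∣ (outside ∷ p) (outside ∷ q) = ∣p∣+∣q∣≡∣p∪q∣+∣p∩q∣ p q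
∣p∣+∣q∣≡∣p∪q∣+∣p∩q∣ (inside ∷ p)  (outside ∷ q) = cong suc (∣p∣+∣q∣≡∣p∪q∣+∣p∩q∣ p q)
∣p∣+∣q∣≡∣p∪q∣+∣p∩q∣ (outside ∷ p) (inside ∷ q)  =
  trans (+-suc ∣ p ∣ ∣ q ∣) (cong suc (∣p∣+∣q∣≡∣p∪q∣+∣p∩q∣ p q))
∣p∣+∣q∣≡∣p∪q∣+∣p∩q∣ (inside ∷ p)  (inside ∷ q)  = cong suc (begin
  ∣ p ∣ + suc ∣ q ∣             ≡⟨ +-suc ∣ p ∣ ∣ q ∣ ⟩
  suc (∣ p ∣ + ∣ q ∣)           ≡⟨ cong suc (∣p∣+∣q∣≡∣p∪q∣+∣p∩q∣ p q) ⟩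
  suc (∣ p ∪ q ∣ + ∣ p ∩ q ∣)   ≡⟨ +-suc ∣ p ∪ q ∣ ∣ p ∩ q ∣ ⟨
  ∣ p ∪ q ∣ + suc ∣ p ∩ q ∣     ∎)
  where open ≡-Reasoning

x∈p─q⁻ : ∀ {m} (p q : Subset m) {x} → x ∈ p ─ q → x ∈ p × x ∉ q
x∈p─q⁻ (inside ∷ p) (outside ∷ q) here = here , λ ()
x∈p─q⁻ (s ∷ p) (inside ∷ q) (there x∈) =
  let x∈p , x∉q = x∈p─q⁻ p q x∈ in there x∈p , λ { (there x∈q) → x∉q x∈q }
x∈p─q⁻ (s ∷ p) (outside ∷ q) (there x∈) =
  let x∈p , x∉q = x∈p─q⁻ p q x∈ in there x∈p , λ { (there x∈q) → x∉q x∈q }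

x∈p-y⁻ : ∀ {m} (p : Subset m) {x y} → x ∈ p - y → x ∈ p × x ≢ y
x∈p-y⁻ p {y = y} x∈ =
  let x∈p , x∉⁅y⁆ = x∈p─q⁻ p ⁅ y ⁆ x∈ in x∈p , λ { refl → x∉⁅y⁆ (x∈⁅x⁆ y) }

x∉p-x : ∀ {m} (p : Subset m) {x} → x ∉ p - x
x∉p-x p x∈ = proj₂ (x∈p-y⁻ p x∈) refl

x∈p∪⁅y⁆⁻ : ∀ {m} (p : Subset m) {x y} → x ∈ p ∪ ⁅ y ⁆ → x ∈ p ⊎ x ≡ y
x∈p∪⁅y⁆⁻ p {y = y} x∈ with x∈p∪q⁻ p ⁅ y ⁆ x∈
... | inj₁ x∈p   = inj₁ x∈p
... | inj₂ x∈⁅y⁆ = inj₂ (x∈⁅y⁆⇒x≡y y x∈⁅y⁆)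

x∈p∪⁅y⁆⁺ : ∀ {m} {p : Subset m} {x y} → x ∈ p ⊎ x ≡ y → x ∈ p ∪ ⁅ y ⁆
x∈p∪⁅y⁆⁺     (inj₁ x∈p)  = x∈p∪q⁺ (inj₁ x∈p)
x∈p∪⁅y⁆⁺ {p = p} (inj₂ refl) = x∈p∪q⁺ {p = p} (inj₂ (x∈⁅x⁆ _))

m∸1+n∸1≤o∸1 : ∀ {m n o} → m + n ≤ o + 1 → m ≤ o → n ≤ o → (m ∸ 1) + (n ∸ 1) ≤ o ∸ 1
m∸1+n∸1≤o∸1 {zero}              _  _   n≤o = ∸-monoˡ-≤ 1 n≤o
m∸1+n∸1≤o∸1 {suc m} {zero}      _  m≤o _   = subst (_≤ _) (sym (+-identityʳ m)) (∸-monoˡ-≤ 1 m≤o)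
m∸1+n∸1≤o∸1 {suc m} {suc n} {zero}  le _ _ with ≤-pred le
... | m+suc[n]≤0 rewrite +-suc m n = contradiction m+suc[n]≤0 λ ()
m∸1+n∸1≤o∸1 {suc m} {suc n} {suc o} le _ _ = ≤-pred (begin
  suc (m + n)      ≡⟨ +-suc m n ⟨
  m + suc n        ≤⟨ ≤-pred le ⟩
  o + 1            ≡⟨ +-comm o 1 ⟩
  suc o            ∎)
  where open ≤-Reasoning

⁅x⁆≡⊥[x]≔inside : ∀ {m} (x : Fin m) → ⁅ x ⁆ ≡ ⊥ [ x ]≔ inside
⁅x⁆≡⊥[x]≔inside zero    = refl
⁅x⁆≡⊥[x]≔inside (suc x) = cong (outside ∷_) (⁅x⁆≡⊥[x]≔inside x)

+-rebalance-≤ : ∀ {m₁ m₂ p₁ p₂ q₁ q₂ n₁ n₂ x y u v} →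
  m₁ ≡ p₁ + x → m₂ ≡ p₂ + y → p₁ + p₂ ≤ q₁ + q₂ → q₁ + u ≤ n₁ → q₂ + v ≤ n₂ → x + y ≤ u + v →
  m₁ + m₂ ≤ n₁ + n₂
+-rebalance-≤ {p₁ = p₁} {p₂} {q₁} {q₂} {n₁} {n₂} {x} {y} {u} {v} refl refl p≤q q₁+u≤n₁ q₂+v≤n₂ x+y≤u+v =
  begin
  (p₁ + x) + (p₂ + y) ≡⟨ interchange p₁ x p₂ y ⟩
  (p₁ + p₂) + (x + y) ≤⟨ +-mono-≤ p≤q x+y≤u+v ⟩
  (q₁ + q₂) + (u + v) ≡⟨ interchange q₁ q₂ u v ⟩
  (q₁ + u) + (q₂ + v) ≤⟨ +-mono-≤ q₁+u≤n₁ q₂+v≤n₂ ⟩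
  n₁ + n₂             ∎
  where open ≤-Reasoning

module PosetMatchings {n : ℕ} (_≼_ : Rel (Fin n) 0ℓ) (P : IsDecPartialOrder _≡_ _≼_) where
  open PosetDefs _≼_ (IsDecPartialOrder._≤?_ P)
  open IsDecPartialOrder P using (antisym) renaming (refl to ≼-refl; trans to ≼-trans; _≤?_ to _≼?_)

  ≺-trans : ∀ {j k l} → j ≺ k → k ≺ l → j ≺ l
  ≺-trans (j≼k , j≢k) (k≼l , _) = ≼-trans j≼k k≼l , λ { refl → j≢k (antisym j≼k k≼l) }

  ≺⇒≢ : ∀ {j i} → j ≺ i → j ≢ i
  ≺⇒≢ = proj₂

  ≺⇒≢′ : ∀ {j i} → j ≺ i → i ≢ j
  ≺⇒≢′ j≺i = ≺⇒≢ j≺i ∘ sym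

  -- Chain weights

  chainBetween? : ∀ j i S → Dec (IsChain S × Between j i S)
  chainBetween? j i S = isChain? S ×-dec between? j i S

  w₁-upperBound : ∀ {i j S} → IsChain S → Between j i S → ∣ S ∣ ∸ 1 ≤ w₁ i j
  w₁-upperBound {i} {j} {S} chain between =
    maxOver-upperBound _ (λ S → ∣ S ∣ ∸ 1) (∈-filter⁺ (chainBetween? j i) (∈-allSubsets S) (chain , between))

  w₁-attained : ∀ i j → ∃[ S ] (IsChain S × Between j i S × w₁ i j ≡ ∣ S ∣ ∸ 1)
  w₁-attained i j
    with maxOver-attained _ (λ S → ∣ S ∣ ∸ 1)
           (∈-filter⁺ (chainBetween? j i) (∈-allSubsets ⊥) ((λ _ _ → ⊥-elim ∘ ∉⊥) , (λ _ → ⊥-elim ∘ ∉⊥)))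
  ... | S , S∈chains , w≡ =
    let chain , between = proj₂ (∈-filter⁻ (chainBetween? j i) {xs = allSubsets n} S∈chains)
    in S , chain , between , w≡

  -- Longest chains from a to i and from c to a meet only in a, so their union is a chain
  -- from c to i with ∣S₁∣ + ∣S₂∣ - 1 elements.
  w₁-superadditive : ∀ {i a c} → c ≼ a → a ≼ i → w₁ i a + w₁ a c ≤ w₁ i c
  w₁-superadditive {i} {a} {c} c≼a a≼i
    with w₁-attained i a | w₁-attained a c
  ... | S₁ , chain₁ , between₁ , w₁≡ | S₂ , chain₂ , between₂ , w₂≡ = begin
    w₁ i a + w₁ a c                ≡⟨ cong₂ _+_ w₁≡ w₂≡ ⟩
    (∣ S₁ ∣ ∸ 1) + (∣ S₂ ∣ ∸ 1)    ≤⟨ m∸1+n∸1≤o∸1 ∣S₁∣+∣S₂∣≤ (∣p∣≤∣p∪q∣ S₁ S₂) (∣q∣≤∣p∪q∣ S₁ S₂) ⟩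
    ∣ S₁ ∪ S₂ ∣ ∸ 1                ≤⟨ w₁-upperBound chain between ⟩
    w₁ i c                         ∎
    where
    open ≤-Reasoning
    meet-at-a : ∀ {x} → x ∈ S₁ ∩ S₂ → x ∈ ⁅ a ⁆
    meet-at-a {x} x∈ =
      let x∈S₁ , x∈S₂ = x∈p∩q⁻ S₁ S₂ x∈
      in subst (_∈ ⁅ a ⁆) (sym (antisym (proj₂ (between₂ x x∈S₂)) (proj₁ (between₁ x x∈S₁)))) (x∈⁅x⁆ a)
    ∣S₁∣+∣S₂∣≤ : ∣ S₁ ∣ + ∣ S₂ ∣ ≤ ∣ S₁ ∪ S₂ ∣ + 1
    ∣S₁∣+∣S₂∣≤ = subst (_≤ ∣ S₁ ∪ S₂ ∣ + 1) (sym (∣p∣+∣q∣≡∣p∪q∣+∣p∩q∣ S₁ S₂))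
      (+-monoʳ-≤ ∣ S₁ ∪ S₂ ∣ (subst (∣ S₁ ∩ S₂ ∣ ≤_) (∣⁅x⁆∣≡1 a) (p⊆q⇒∣p∣≤∣q∣ meet-at-a)))
    chain : IsChain (S₁ ∪ S₂)
    chain s t s∈ t∈ with x∈p∪q⁻ S₁ S₂ s∈ | x∈p∪q⁻ S₁ S₂ t∈
    ... | inj₁ s∈S₁ | inj₁ t∈S₁ = chain₁ s t s∈S₁ t∈S₁
    ... | inj₂ s∈S₂ | inj₂ t∈S₂ = chain₂ s t s∈S₂ t∈S₂
    ... | inj₁ s∈S₁ | inj₂ t∈S₂ = inj₂ (≼-trans (proj₂ (between₂ t t∈S₂)) (proj₁ (between₁ s s∈S₁)))
    ... | inj₂ s∈S₂ | inj₁ t∈S₁ = inj₁ (≼-trans (proj₂ (between₂ s s∈S₂)) (proj₁ (between₁ t t∈S₁)))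
    between : Between c i (S₁ ∪ S₂)
    between s s∈ with x∈p∪q⁻ S₁ S₂ s∈
    ... | inj₁ s∈S₁ = ≼-trans c≼a (proj₁ (between₁ s s∈S₁)) , proj₂ (between₁ s s∈S₁)
    ... | inj₂ s∈S₂ = proj₁ (between₂ s s∈S₂) , ≼-trans (proj₂ (between₂ s s∈S₂)) a≼i

  w₁-positive : ∀ {i j} → j ≺ i → 0 < w₁ i j
  w₁-positive {i} {j} (j≼i , j≢i) = begin
    1                        ≡⟨⟩
    2 ∸ 1                    ≤⟨ ∸-monoˡ-≤ 1 (subst (_< ∣ S ∣) (∣⁅x⁆∣≡1 i) ∣⁅i⁆∣<∣S∣) ⟩
    ∣ S ∣ ∸ 1                ≤⟨ w₁-upperBound chain between ⟩
    w₁ i j                   ∎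
    where
    open ≤-Reasoning
    S : Subset n
    S = ⁅ i ⁆ ∪ ⁅ j ⁆
    ∣⁅i⁆∣<∣S∣ : ∣ ⁅ i ⁆ ∣ < ∣ S ∣
    ∣⁅i⁆∣<∣S∣ = p⊂q⇒∣p∣<∣q∣ (p⊆p∪q ⁅ j ⁆ , j , q⊆p∪q ⁅ i ⁆ ⁅ j ⁆ (x∈⁅x⁆ j) , x≢y⇒x∉⁅y⁆ j≢i)
    element : ∀ {s} → s ∈ S → s ≡ i ⊎ s ≡ j
    element s∈ with x∈p∪⁅y⁆⁻ ⁅ i ⁆ s∈
    ... | inj₁ s∈⁅i⁆ = inj₁ (x∈⁅y⁆⇒x≡y i s∈⁅i⁆)
    ... | inj₂ s≡j   = inj₂ s≡j
    chain : IsChain S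
    chain s t s∈ t∈ with element s∈ | element t∈
    ... | inj₁ refl | inj₁ refl = inj₁ ≼-refl
    ... | inj₁ refl | inj₂ refl = inj₂ j≼i
    ... | inj₂ refl | inj₁ refl = inj₁ j≼i
    ... | inj₂ refl | inj₂ refl = inj₁ ≼-refl
    between : Between j i S
    between s s∈ with element s∈
    ... | inj₁ refl = j≼i , ≼-refl
    ... | inj₂ refl = ≼-refl , j≼i

  -- Matchings as edge sets

  -- Unlike InM, a record type lets Agda infer M, h and t from it.
  record Edge (M : EdgeSet) (h t : Fin n) : Set where
    constructor edge
    field inM : InM M h t

  record IsE₁Matching (M : EdgeSet) : Set where
    field
      edge-≺     : ∀ {h t} → Edge M h t → t ≺ h
      uniqueTail : ∀ {h t t′} → Edge M h t → Edge M h t′ → t ≡ t′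
      uniqueHead : ∀ {h h′ t} → Edge M h t → Edge M h′ t → h ≡ h′

  record IsAdmissible (Z : Subset n) (M : EdgeSet) : Set where
    field
      matching : IsE₁Matching M
      head∈    : ∀ {h t} → Edge M h t → h ∈ Z
      tail∉    : ∀ {h t} → Edge M h t → t ∉ Z

  open IsE₁Matching public
  open IsAdmissible public

  toAdmissible : ∀ {Z M} → IsAdmissible Z M → Admissible Z M
  toAdmissible adm =
    (λ h t e → edge-≺ (matching adm) (edge e)) ,
    ((λ h t t′ e f → uniqueTail (matching adm) (edge e) (edge f)) ,
     (λ h h′ t e f → uniqueHead (matching adm) (edge e) (edge f))) ,
    (λ h t e → head∈ adm (edge e) , tail∉ adm (edge e))

  fromAdmissible : ∀ {Z} M → Admissible Z M → IsAdmissible Z M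
  fromAdmissible M (sub , (unique-tail , unique-head) , boundary) = record
    { matching = record
      { edge-≺     = λ { {h} {t} (edge e) → sub h t e }
      ; uniqueTail = λ { {h} {t} {t′} (edge e) (edge f) → unique-tail h t t′ e f }
      ; uniqueHead = λ { {h} {h′} {t} (edge e) (edge f) → unique-head h h′ t e f } }
    ; head∈ = λ { {h} {t} (edge e) → proj₁ (boundary h t e) }
    ; tail∉ = λ { {h} {t} (edge e) → proj₂ (boundary h t e) } }

  child? : ∀ M h → Dec (∃[ t ] Edge M h t)
  child? M h with any? (λ t → t ∈? lookup M h)
  ... | yes (t , e) = yes (t , edge e)
  ... | no none     = no λ { (t , edge e) → none (t , e) }

  parent? : ∀ M t → Dec (∃[ h ] Edge M h t)
  parent? M t with any? (λ h → t ∈? lookup M h)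
  ... | yes (h , e) = yes (h , edge e)
  ... | no none     = no λ { (h , edge e) → none (h , e) }

  _∈∂_ : Fin n → EdgeSet → Set
  x ∈∂ M = ∃[ y ] (Edge M x y ⊎ Edge M y x)

  head∈∂ : ∀ {M h t} → Edge M h t → h ∈∂ M
  head∈∂ e = _ , inj₁ e

  tail∈∂ : ∀ {M h t} → Edge M h t → t ∈∂ M
  tail∈∂ e = _ , inj₂ e

  ∉∂⁺ : ∀ {M x} → ¬ (∃[ h ] Edge M h x) → ¬ (∃[ t ] Edge M x t) → ¬ x ∈∂ M
  ∉∂⁺ no-parent no-child (y , inj₁ e) = no-child (y , e)
  ∉∂⁺ no-parent no-child (y , inj₂ e) = no-parent (y , e)

  ∉∂-childless : ∀ {Z M h} → IsAdmissible Z M → h ∈ Z → (∀ t → ¬ Edge M h t) → ¬ h ∈∂ M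
  ∉∂-childless adm h∈Z childless (t , inj₁ e) = childless t e
  ∉∂-childless adm h∈Z childless (t , inj₂ e) = tail∉ adm e h∈Z

  noEdges : EdgeSet
  noEdges = replicate n ⊥

  ¬Edge-noEdges : ∀ {h t} → ¬ Edge noEdges h t
  ¬Edge-noEdges {h} (edge e) = ∉⊥ (subst (_ ∈_) (lookup-replicate h ⊥) e)

  noEdges-matching : IsE₁Matching noEdges
  noEdges-matching = record
    { edge-≺     = ⊥-elim ∘ ¬Edge-noEdges
    ; uniqueTail = λ e _ → ⊥-elim (¬Edge-noEdges e)
    ; uniqueHead = λ e _ → ⊥-elim (¬Edge-noEdges e) }

  noEdges-admissible : ∀ {Z} → IsAdmissible Z noEdges
  noEdges-admissible = record
    { matching = noEdges-matching ; head∈ = ⊥-elim ∘ ¬Edge-noEdges ; tail∉ = ⊥-elim ∘ ¬Edge-noEdges }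

  setRow : EdgeSet → Fin n → Fin n → EdgeSet
  setRow M h t = M [ h ]≔ ⁅ t ⁆

  clearRow : EdgeSet → Fin n → EdgeSet
  clearRow M h = M [ h ]≔ ⊥

  Edge-update⁻ : ∀ {M h S k j} → Edge (M [ h ]≔ S) k j → (k ≡ h × j ∈ S) ⊎ (k ≢ h × Edge M k j)
  Edge-update⁻ {M} {h} {S} {k} {j} (edge e) with k ≟ h
  ... | yes refl = inj₁ (refl , subst (j ∈_) (lookup∘update h M S) e)
  ... | no k≢h   = inj₂ (k≢h , edge (subst (j ∈_) (lookup∘update′ k≢h M S) e))

  Edge-setRow⁻ : ∀ {M h t k j} → Edge (setRow M h t) k j → (k ≡ h × j ≡ t) ⊎ (k ≢ h × Edge M k j)
  Edge-setRow⁻ {t = t} e with Edge-update⁻ e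
  ... | inj₁ (k≡h , j∈⁅t⁆) = inj₁ (k≡h , x∈⁅y⁆⇒x≡y t j∈⁅t⁆)
  ... | inj₂ other         = inj₂ other

  Edge-clearRow⁻ : ∀ {M h k j} → Edge (clearRow M h) k j → k ≢ h × Edge M k j
  Edge-clearRow⁻ e with Edge-update⁻ e
  ... | inj₁ (_ , j∈⊥) = ⊥-elim (∉⊥ j∈⊥)
  ... | inj₂ other     = other

  setRow-matching : ∀ {M h t} → IsE₁Matching M → t ≺ h → (∀ k → k ≢ h → ¬ Edge M k t) →
                    IsE₁Matching (setRow M h t)
  setRow-matching {M} {h} {t} m t≺h t-fresh = record
    { edge-≺ = sub ; uniqueTail = unique-tail ; uniqueHead = unique-head }
    where
    sub : ∀ {k j} → Edge (setRow M h t) k j → j ≺ k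
    sub e with Edge-setRow⁻ e
    ... | inj₁ (refl , refl) = t≺h
    ... | inj₂ (_ , e′)      = edge-≺ m e′
    unique-tail : ∀ {k j j′} → Edge (setRow M h t) k j → Edge (setRow M h t) k j′ → j ≡ j′
    unique-tail e f with Edge-setRow⁻ e | Edge-setRow⁻ f
    ... | inj₁ (_ , refl)  | inj₁ (_ , refl)  = refl
    ... | inj₁ (k≡h , _)   | inj₂ (k≢h , _)   = ⊥-elim (k≢h k≡h)
    ... | inj₂ (k≢h , _)   | inj₁ (k≡h , _)   = ⊥-elim (k≢h k≡h)
    ... | inj₂ (_ , e′)    | inj₂ (_ , f′)    = uniqueTail m e′ f′
    unique-head : ∀ {k k′ j} → Edge (setRow M h t) k j → Edge (setRow M h t) k′ j → k ≡ k′
    unique-head {k} {k′} e f with Edge-setRow⁻ e | Edge-setRow⁻ f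
    ... | inj₁ (refl , _)    | inj₁ (refl , _)    = refl
    ... | inj₁ (refl , refl) | inj₂ (k′≢h , f′)   = ⊥-elim (t-fresh k′ k′≢h f′)
    ... | inj₂ (k≢h , e′)    | inj₁ (refl , refl) = ⊥-elim (t-fresh k k≢h e′)
    ... | inj₂ (_ , e′)      | inj₂ (_ , f′)      = uniqueHead m e′ f′

  clearRow-matching : ∀ {M h} → IsE₁Matching M → IsE₁Matching (clearRow M h)
  clearRow-matching m = record
    { edge-≺     = edge-≺ m ∘ proj₂ ∘ Edge-clearRow⁻
    ; uniqueTail = λ e f → uniqueTail m (proj₂ (Edge-clearRow⁻ e)) (proj₂ (Edge-clearRow⁻ f))
    ; uniqueHead = λ e f → uniqueHead m (proj₂ (Edge-clearRow⁻ e)) (proj₂ (Edge-clearRow⁻ f)) }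

  ∂-clearRow : ∀ {M h x} → x ∈∂ clearRow M h → x ∈∂ M
  ∂-clearRow (y , inj₁ e) = y , inj₁ (proj₂ (Edge-clearRow⁻ e))
  ∂-clearRow (y , inj₂ e) = y , inj₂ (proj₂ (Edge-clearRow⁻ e))

  tail∉∂-clearRow : ∀ {Z M h t} → IsAdmissible Z M → Edge M h t → ¬ t ∈∂ clearRow M h
  tail∉∂-clearRow adm h→t (y , inj₁ e) = tail∉ adm h→t (head∈ adm (proj₂ (Edge-clearRow⁻ e)))
  tail∉∂-clearRow adm h→t (y , inj₂ e) =
    let y≢h , y→t = Edge-clearRow⁻ e in y≢h (uniqueHead (matching adm) y→t h→t)

  clearRow-admissible : ∀ {Z M h} → IsAdmissible Z M → IsAdmissible (Z - h) (clearRow M h)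
  clearRow-admissible adm = record
    { matching = clearRow-matching (matching adm)
    ; head∈ = λ e → let k≢h , e′ = Edge-clearRow⁻ e in x∈p∧x≢y⇒x∈p-y (head∈ adm e′) k≢h
    ; tail∉ = λ e → tail∉ adm (proj₂ (Edge-clearRow⁻ e)) ∘ proj₁ ∘ x∈p-y⁻ _ }

  childless-admissible : ∀ {Z M h} → IsAdmissible Z M → (∀ t → ¬ Edge M h t) → IsAdmissible (Z - h) M
  childless-admissible adm childless = record
    { matching = matching adm
    ; head∈ = λ { {t = t} e → x∈p∧x≢y⇒x∈p-y (head∈ adm e) (λ { refl → childless t e }) }
    ; tail∉ = λ e → tail∉ adm e ∘ proj₁ ∘ x∈p-y⁻ _ }

  parentless-admissible : ∀ {Z M t} → IsAdmissible Z M → (∀ h → ¬ Edge M h t) →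
                          IsAdmissible (Z ∪ ⁅ t ⁆) M
  parentless-admissible adm parentless = record
    { matching = matching adm
    ; head∈ = λ e → x∈p∪⁅y⁆⁺ (inj₁ (head∈ adm e))
    ; tail∉ = λ { {h} e → [ tail∉ adm e , (λ { refl → parentless h e }) ]′ ∘ x∈p∪⁅y⁆⁻ _ } }

  entryWeight : Fin n → Fin n → Bool → ℕ
  entryWeight h j b = if b then w₁ h j else 0

  rowWeight : Fin n → Subset n → ℕ
  rowWeight h S = sum (map (λ j → entryWeight h j (lookup S j)) (allFin n))

  weight-update : ∀ M h S → weight (M [ h ]≔ S) + rowWeight h (lookup M h) ≡ weight M + rowWeight h S
  weight-update = sum-lookup-update rowWeight

  rowWeight-⊥ : ∀ h → rowWeight h ⊥ ≡ 0
  rowWeight-⊥ h = trans (sum-allFin (λ j → entryWeight h j (lookup ⊥ j)))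
    (sum-tabulate-zero _ λ k → cong (entryWeight h k) (lookup-replicate k outside))

  rowWeight-⁅⁆ : ∀ h t → rowWeight h ⁅ t ⁆ ≡ w₁ h t
  rowWeight-⁅⁆ h t rewrite ⁅x⁆≡⊥[x]≔inside t = begin
    rowWeight h (⊥ [ t ]≔ inside)
      ≡⟨ +-identityʳ _ ⟨
    rowWeight h (⊥ [ t ]≔ inside) + 0
      ≡⟨ cong (λ b → rowWeight h (⊥ [ t ]≔ inside) + entryWeight h t b) (lookup-replicate t outside) ⟨
    rowWeight h (⊥ [ t ]≔ inside) + entryWeight h t (lookup ⊥ t)
      ≡⟨ sum-lookup-update (entryWeight h) ⊥ t inside ⟩
    rowWeight h ⊥ + w₁ h t
      ≡⟨ cong (_+ w₁ h t) (rowWeight-⊥ h) ⟩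
    w₁ h t
      ∎
    where open ≡-Reasoning

  rowWeight-single : ∀ {M h t} → IsE₁Matching M → Edge M h t → rowWeight h (lookup M h) ≡ w₁ h t
  rowWeight-single {M} {h} {t} m (edge e) = trans (cong (rowWeight h) row≡⁅t⁆) (rowWeight-⁅⁆ h t)
    where
    row≡⁅t⁆ : lookup M h ≡ ⁅ t ⁆
    row≡⁅t⁆ = ⊆-antisym (λ x∈ → subst (_∈ ⁅ t ⁆) (uniqueTail m (edge e) (edge x∈)) (x∈⁅x⁆ t))
                        (λ x∈ → subst (_∈ lookup M h) (sym (x∈⁅y⁆⇒x≡y t x∈)) e)

  rowWeight-empty : ∀ {M h} → (∀ t → ¬ Edge M h t) → rowWeight h (lookup M h) ≡ 0
  rowWeight-empty {h = h} childless =
    trans (cong (rowWeight h) (Empty-unique λ (t , e) → childless t (edge e))) (rowWeight-⊥ h)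

  weight-clearRow : ∀ {M h t} → IsE₁Matching M → Edge M h t → weight M ≡ weight (clearRow M h) + w₁ h t
  weight-clearRow {M} {h} {t} m e = begin
    weight M                                          ≡⟨ +-identityʳ _ ⟨
    weight M + 0                                      ≡⟨ cong (weight M +_) (rowWeight-⊥ h) ⟨
    weight M + rowWeight h ⊥                          ≡⟨ weight-update M h ⊥ ⟨
    weight (clearRow M h) + rowWeight h (lookup M h)  ≡⟨ cong (weight (clearRow M h) +_) (rowWeight-single m e) ⟩
    weight (clearRow M h) + w₁ h t                    ∎
    where open ≡-Reasoning

  weight-setRow-fresh : ∀ {M h} t → (∀ s → ¬ Edge M h s) → weight (setRow M h t) ≡ weight M + w₁ h t
  weight-setRow-fresh {M} {h} t childless = begin
    weight (setRow M h t)                              ≡⟨ +-identityʳ _ ⟨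
    weight (setRow M h t) + 0                          ≡⟨ cong (weight (setRow M h t) +_) (rowWeight-empty childless) ⟨
    weight (setRow M h t) + rowWeight h (lookup M h)   ≡⟨ weight-update M h ⁅ t ⁆ ⟩
    weight M + rowWeight h ⁅ t ⁆                       ≡⟨ cong (weight M +_) (rowWeight-⁅⁆ h t) ⟩
    weight M + w₁ h t                                  ∎
    where open ≡-Reasoning

  weight-setRow-replace : ∀ {M h t₀} t → IsE₁Matching M → Edge M h t₀ →
                          weight (setRow M h t) + w₁ h t₀ ≡ weight M + w₁ h t
  weight-setRow-replace {M} {h} {t₀} t m e = begin
    weight (setRow M h t) + w₁ h t₀                    ≡⟨ cong (weight (setRow M h t) +_) (rowWeight-single m e) ⟨
    weight (setRow M h t) + rowWeight h (lookup M h)   ≡⟨ weight-update M h ⁅ t ⁆ ⟩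
    weight M + rowWeight h ⁅ t ⁆                       ≡⟨ cong (weight M +_) (rowWeight-⁅⁆ h t) ⟩
    weight M + w₁ h t                                  ∎
    where open ≡-Reasoning

  weight-edgeless : ∀ {M} → (∀ h t → ¬ Edge M h t) → weight M ≡ 0
  weight-edgeless {M} none = trans (sum-allFin (λ h → rowWeight h (lookup M h)))
    (sum-tabulate-zero _ λ h → rowWeight-empty (none h))

  record Attachment (M : EdgeSet) (b t : Fin n) : Set where
    field
      N          : EdgeSet
      N-matching : IsE₁Matching N
      weight≤    : weight M + w₁ b t ≤ weight N
      edge⁻      : ∀ {h s} → Edge N h s → (Edge M h s × s ≢ b) ⊎ (s ≡ t × (h ≡ b ⊎ Edge M h b))

  -- If b already has a parent p, the edge p → b is redirected to p → t instead of adding b → t;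
  -- by superadditivity of w₁ this also gains at least w₁ b t.
  attach : ∀ {M b t} → IsE₁Matching M → t ≺ b → ¬ t ∈∂ M → (∀ s → ¬ Edge M b s) → Attachment M b t
  attach {M} {b} {t} m t≺b t∉∂M b-childless with parent? M b
  ... | yes (p , p→b) = record
    { N = setRow M p t
    ; N-matching = setRow-matching m (≺-trans t≺b b≺p) t-fresh
    ; weight≤ = +-cancelʳ-≤ (w₁ p b) _ _ (begin
        weight M + w₁ b t + w₁ p b      ≡⟨ +-assoc (weight M) _ _ ⟩
        weight M + (w₁ b t + w₁ p b)    ≡⟨ cong (weight M +_) (+-comm (w₁ b t) (w₁ p b)) ⟩
        weight M + (w₁ p b + w₁ b t)    ≤⟨ +-monoʳ-≤ (weight M) (w₁-superadditive (proj₁ t≺b) (proj₁ b≺p)) ⟩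
        weight M + w₁ p t               ≡⟨ weight-setRow-replace t m p→b ⟨
        weight (setRow M p t) + w₁ p b  ∎)
    ; edge⁻ = redirected }
    where
    open ≤-Reasoning
    b≺p : b ≺ p
    b≺p = edge-≺ m p→b
    t-fresh : ∀ k → k ≢ p → ¬ Edge M k t
    t-fresh k _ e = t∉∂M (tail∈∂ e)
    redirected : ∀ {h s} → Edge (setRow M p t) h s → (Edge M h s × s ≢ b) ⊎ (s ≡ t × (h ≡ b ⊎ Edge M h b))
    redirected e with Edge-setRow⁻ e
    ... | inj₁ (refl , refl) = inj₂ (refl , inj₂ p→b)
    ... | inj₂ (h≢p , e′)    = inj₁ (e′ , λ { refl → h≢p (uniqueHead m e′ p→b) })
  ... | no parentless = record
    { N = setRow M b t
    ; N-matching = setRow-matching m t≺b λ k _ e → t∉∂M (tail∈∂ e)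
    ; weight≤ = ≤-reflexive (sym (weight-setRow-fresh t b-childless))
    ; edge⁻ = added }
    where
    added : ∀ {h s} → Edge (setRow M b t) h s → (Edge M h s × s ≢ b) ⊎ (s ≡ t × (h ≡ b ⊎ Edge M h b))
    added e with Edge-setRow⁻ e
    ... | inj₁ (refl , refl) = inj₂ (refl , inj₁ refl)
    ... | inj₂ (_ , e′)      = inj₁ (e′ , λ { refl → parentless (_ , e′) })

  module _ {M b t} (A : Attachment M b t) where
    open Attachment A

    attachment-∂-elim : ∀ {P : Fin n → Set} → (∀ {x} → x ∈∂ M → P x) → P b → P t → ∀ {x} → x ∈∂ N → P x
    attachment-∂-elim old new-b new-t (y , inj₁ e) with edge⁻ e
    ... | inj₁ (e′ , _)           = old (head∈∂ e′)
    ... | inj₂ (_ , inj₁ refl)    = new-b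
    ... | inj₂ (_ , inj₂ x→b)     = old (head∈∂ x→b)
    attachment-∂-elim old new-b new-t (y , inj₂ e) with edge⁻ e
    ... | inj₁ (e′ , _)           = old (tail∈∂ e′)
    ... | inj₂ (refl , _)         = new-t

    attachment-admissible : ∀ {Z} → (∀ {h s} → Edge M h s → h ∈ Z) → (∀ {h s} → Edge M h s → s ≢ b → s ∉ Z) →
                            b ∈ Z → t ∉ Z → IsAdmissible Z N
    attachment-admissible heads∈ tails∉ b∈Z t∉Z = record
      { matching = N-matching ; head∈ = head∈N ; tail∉ = tail∉N }
      where
      head∈N : ∀ {h s} → Edge N h s → h ∈ _
      head∈N e with edge⁻ e
      ... | inj₁ (e′ , _)          = heads∈ e′
      ... | inj₂ (_ , inj₁ refl)   = b∈Z
      ... | inj₂ (_ , inj₂ h→b)    = heads∈ h→b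
      tail∉N : ∀ {h s} → Edge N h s → s ∉ _
      tail∉N e with edge⁻ e
      ... | inj₁ (e′ , s≢b)        = tails∉ e′ s≢b
      ... | inj₂ (refl , _)        = t∉Z

  -- The exchange argument

  data Choice (X Y : Subset n) : Set where
    remove : Choice X Y
    swap   : ∀ j → j ∈ Y → j ∉ X → Choice X Y

  module _ {X Y : Subset n} where
    targetX : Choice X Y → Fin n → Subset n
    targetX remove       i = X - i
    targetX (swap j _ _) i = (X - i) ∪ ⁅ j ⁆

    targetY : Choice X Y → Fin n → Subset n
    targetY remove       i = Y ∪ ⁅ i ⁆
    targetY (swap j _ _) i = (Y ∪ ⁅ i ⁆) - j

    Swapped : Choice X Y → Fin n → Set
    Swapped remove       x = Empty
    Swapped (swap j _ _) x = x ≡ j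

    swapped∈Y : ∀ c {x} → Swapped c x → x ∈ Y
    swapped∈Y (swap j j∈Y _) refl = j∈Y

    ∈targetX⁺ : ∀ c {i x} → (x ∈ X × x ≢ i) ⊎ Swapped c x → x ∈ targetX c i
    ∈targetX⁺ remove       (inj₁ (x∈X , x≢i)) = x∈p∧x≢y⇒x∈p-y x∈X x≢i
    ∈targetX⁺ (swap j _ _) (inj₁ (x∈X , x≢i)) = x∈p∪⁅y⁆⁺ (inj₁ (x∈p∧x≢y⇒x∈p-y x∈X x≢i))
    ∈targetX⁺ (swap j _ _) (inj₂ x≡j)         = x∈p∪⁅y⁆⁺ (inj₂ x≡j)

    ∈targetX⁻ : ∀ c {i x} → x ∈ targetX c i → (x ∈ X × x ≢ i) ⊎ Swapped c x
    ∈targetX⁻ remove       x∈ = inj₁ (x∈p-y⁻ X x∈)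
    ∈targetX⁻ (swap j _ _) x∈ with x∈p∪⁅y⁆⁻ (X - _) x∈
    ... | inj₁ x∈X-i = inj₁ (x∈p-y⁻ X x∈X-i)
    ... | inj₂ x≡j   = inj₂ x≡j

    ∈targetY⁺ : ∀ c {i x} → x ∈ Y ⊎ x ≡ i → ¬ Swapped c x → x ∈ targetY c i
    ∈targetY⁺ remove       x∈ _   = x∈p∪⁅y⁆⁺ x∈
    ∈targetY⁺ (swap j _ _) x∈ x≢j = x∈p∧x≢y⇒x∈p-y (x∈p∪⁅y⁆⁺ x∈) x≢j

    ∈targetY⁻ : ∀ c {i x} → x ∈ targetY c i → (x ∈ Y ⊎ x ≡ i) × ¬ Swapped c x
    ∈targetY⁻ remove       x∈ = x∈p∪⁅y⁆⁻ Y x∈ , λ ()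
    ∈targetY⁻ (swap j _ _) x∈ = let x∈Y∪⁅i⁆ , x≢j = x∈p-y⁻ (Y ∪ ⁅ _ ⁆) x∈ in x∈p∪⁅y⁆⁻ Y x∈Y∪⁅i⁆ , x≢j

    ∉targetX : ∀ c {i x} → x ∉ X ⊎ x ≡ i → ¬ Swapped c x → x ∉ targetX c i
    ∉targetX c out not-swapped x∈ with ∈targetX⁻ c x∈ | out
    ... | inj₁ (x∈X , _)   | inj₁ x∉X = x∉X x∈X
    ... | inj₁ (_ , x≢i)   | inj₂ x≡i = x≢i x≡i
    ... | inj₂ swapped     | _        = not-swapped swapped

    ∉targetY : ∀ c {i x} → x ∉ Y → x ≢ i → x ∉ targetY c i
    ∉targetY c x∉Y x≢i x∈ = [ x∉Y , x≢i ]′ (proj₁ (∈targetY⁻ c x∈))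

    swapped∉targetY : ∀ c {i x} → Swapped c x → x ∉ targetY c i
    swapped∉targetY c swapped x∈ = proj₂ (∈targetY⁻ c x∈) swapped

    self∉targetX : ∀ c {i} → i ∉ Y → i ∉ targetX c i
    self∉targetX c i∉Y = ∉targetX c (inj₂ refl) (i∉Y ∘ swapped∈Y c)

  liftChoice : ∀ {X Y i b} → i ∉ Y → Choice (X - i) (Y - b) → Choice X Y
  liftChoice i∉Y remove = remove
  liftChoice {X} {Y} i∉Y (swap j j∈Y-b j∉X-i) =
    swap j j∈Y λ j∈X → j∉X-i (x∈p∧x≢y⇒x∈p-y j∈X λ { refl → i∉Y j∈Y })
    where
    j∈Y : j ∈ Y
    j∈Y = proj₁ (x∈p-y⁻ Y j∈Y-b)

  module _ {X Y : Subset n} {i b : Fin n} (i∉Y : i ∉ Y) where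
    Swapped-lift⁺ : ∀ c {x} → Swapped c x → Swapped (liftChoice {X} {Y} {i} {b} i∉Y c) x
    Swapped-lift⁺ (swap j _ _) x≡j = x≡j

    Swapped-lift⁻ : ∀ c {x} → Swapped (liftChoice {X} {Y} {i} {b} i∉Y c) x → Swapped c x
    Swapped-lift⁻ (swap j _ _) x≡j = x≡j

    targetX-lift⁺ : ∀ c {x} → x ∈ targetX c b → x ∈ targetX (liftChoice i∉Y c) i
    targetX-lift⁺ c x∈ with ∈targetX⁻ c x∈
    ... | inj₁ (x∈X-i , _) = ∈targetX⁺ (liftChoice i∉Y c) (inj₁ (x∈p-y⁻ X x∈X-i))
    ... | inj₂ swapped     = ∈targetX⁺ (liftChoice i∉Y c) (inj₂ (Swapped-lift⁺ c swapped))

    targetX-lift⁻ : ∀ c {x} → x ∉ targetX c b → x ≢ b → x ∉ targetX (liftChoice i∉Y c) i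
    targetX-lift⁻ c x∉ x≢b x∈ with ∈targetX⁻ (liftChoice i∉Y c) x∈
    ... | inj₁ (x∈X , x≢i) = x∉ (∈targetX⁺ c (inj₁ (x∈p∧x≢y⇒x∈p-y x∈X x≢i , x≢b)))
    ... | inj₂ swapped     = x∉ (∈targetX⁺ c (inj₂ (Swapped-lift⁻ c swapped)))

    targetY-lift⁺ : b ∈ Y → ∀ c {x} → x ∈ targetY c b → x ∈ targetY (liftChoice i∉Y c) i
    targetY-lift⁺ b∈Y c x∈ =
      let x∈Y-b⊎x≡b , not-swapped = ∈targetY⁻ c x∈
      in ∈targetY⁺ (liftChoice i∉Y c) (inj₁ ([ proj₁ ∘ x∈p-y⁻ Y , (λ { refl → b∈Y }) ]′ x∈Y-b⊎x≡b))
                   (not-swapped ∘ Swapped-lift⁻ c)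

    targetY-lift⁻ : ∀ c {x} → x ∉ targetY c b → x ≢ i → x ∉ targetY (liftChoice i∉Y c) i
    targetY-lift⁻ c {x} x∉ x≢i x∈ with ∈targetY⁻ (liftChoice i∉Y c) x∈
    ... | inj₂ x≡i , _           = x≢i x≡i
    ... | inj₁ x∈Y , not-swapped = x∉ (∈targetY⁺ c x∈Y-b⊎x≡b (not-swapped ∘ Swapped-lift⁺ c))
      where
      x∈Y-b⊎x≡b : x ∈ Y - b ⊎ x ≡ b
      x∈Y-b⊎x≡b with x ≟ b
      ... | yes x≡b = inj₂ x≡b
      ... | no x≢b  = inj₁ (x∈p∧x≢y⇒x∈p-y x∈Y x≢b)

  -- ∂N⊆∂M is what the recursive cases need: vertices missed by M₁ and M₂ stay free in N₁ and N₂.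
  record Exchange (X Y : Subset n) (i : Fin n) (M₁ M₂ : EdgeSet) : Set where
    field
      choice        : Choice X Y
      N₁ N₂         : EdgeSet
      N₁-admissible : IsAdmissible (targetX choice i) N₁
      N₂-admissible : IsAdmissible (targetY choice i) N₂
      weight≤       : weight M₁ + weight M₂ ≤ weight N₁ + weight N₂
      ∂N⊆∂M         : ∀ {x} → x ∈∂ N₁ ⊎ x ∈∂ N₂ → x ∈∂ M₁ ⊎ x ∈∂ M₂

  module _ {X Y i M₁ M₂} (r : Exchange X Y i M₁ M₂) where
    open Exchange r

    ∉∂N₁ : ∀ {x} → ¬ x ∈∂ M₁ → ¬ x ∈∂ M₂ → ¬ x ∈∂ N₁
    ∉∂N₁ x∉∂M₁ x∉∂M₂ = [ x∉∂M₁ , x∉∂M₂ ]′ ∘ ∂N⊆∂M ∘ inj₁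

    ∉∂N₂ : ∀ {x} → ¬ x ∈∂ M₁ → ¬ x ∈∂ M₂ → ¬ x ∈∂ N₂
    ∉∂N₂ x∉∂M₁ x∉∂M₂ = [ x∉∂M₁ , x∉∂M₂ ]′ ∘ ∂N⊆∂M ∘ inj₂

  -- Cases are named after i's child a in M₁, its parent b in M₂, and the neighbours of a in M₂.
  module ExchangeCases {X Y i M₁ M₂} (adm₁ : IsAdmissible X M₁) (adm₂ : IsAdmissible Y M₂)
                       (i∈X : i ∈ X) (i∉Y : i ∉ Y) where
    private
      m₁ : IsE₁Matching M₁
      m₁ = matching adm₁
      m₂ : IsE₁Matching M₂
      m₂ = matching adm₂
      open Attachment using (N)

    isolated : (∀ t → ¬ Edge M₁ i t) → (∀ h → ¬ Edge M₂ h i) → Exchange X Y i M₁ M₂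
    isolated childless parentless = record
      { choice = remove ; N₁ = M₁ ; N₂ = M₂
      ; N₁-admissible = childless-admissible adm₁ childless
      ; N₂-admissible = parentless-admissible adm₂ parentless
      ; weight≤ = ≤-refl
      ; ∂N⊆∂M = λ x∈∂ → x∈∂ }

    parentOutside : ∀ {b} → (∀ t → ¬ Edge M₁ i t) → Edge M₂ b i → b ∉ X → Exchange X Y i M₁ M₂
    parentOutside {b} childless b→i b∉X = record
      { choice = c ; N₁ = N A ; N₂ = clearRow M₂ b
      ; N₁-admissible = attachment-admissible A
          (λ e → ∈targetX⁺ c (inj₁ (head∈ adm₁ e , λ { refl → childless _ e })))
          (λ e s≢b → ∉targetX c (inj₁ (tail∉ adm₁ e)) s≢b)
          (∈targetX⁺ c (inj₂ refl)) (∉targetX c (inj₂ refl) (≺⇒≢ i≺b))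
      ; N₂-admissible = record
          { matching = clearRow-matching m₂
          ; head∈ = λ e → let h≢b , e′ = Edge-clearRow⁻ e in ∈targetY⁺ c (inj₁ (head∈ adm₂ e′)) h≢b
          ; tail∉ = λ e → let h≢b , e′ = Edge-clearRow⁻ e
                          in ∉targetY c (tail∉ adm₂ e′) λ { refl → h≢b (uniqueHead m₂ e′ b→i) } }
      ; weight≤ = +-rebalance-≤ {x = 0} {w₁ b i} {w₁ b i} {0} (sym (+-identityʳ (weight M₁)))
                    (weight-clearRow m₂ b→i) ≤-refl (Attachment.weight≤ A)
                    (≤-reflexive (+-identityʳ (weight (clearRow M₂ b)))) (≤-reflexive (+-comm 0 (w₁ b i)))
      ; ∂N⊆∂M = [ attachment-∂-elim A inj₁ (inj₂ (head∈∂ b→i)) (inj₂ (tail∈∂ b→i)) , inj₂ ∘ ∂-clearRow ]′ }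
      where
      c : Choice X Y
      c = swap b (head∈ adm₂ b→i) b∉X
      i≺b : i ≺ b
      i≺b = edge-≺ m₂ b→i
      A : Attachment M₁ b i
      A = attach m₁ i≺b (∉∂-childless adm₁ i∈X childless) (λ s e → b∉X (head∈ adm₁ e))

    parentInside : ∀ {b} → (∀ t → ¬ Edge M₁ i t) → Edge M₂ b i → b ∈ X →
                   Exchange (X - i) (Y - b) b M₁ (clearRow M₂ b) → Exchange X Y i M₁ M₂
    parentInside {b} childless b→i b∈X r = record
      { choice = liftChoice i∉Y c ; N₁ = N A ; N₂ = N₂″
      ; N₁-admissible = attachment-admissible A
          (targetX-lift⁺ i∉Y c ∘ head∈ adm₁″) (λ e s≢b → targetX-lift⁻ i∉Y c (tail∉ adm₁″ e) s≢b)
          (∈targetX⁺ (liftChoice i∉Y c) (inj₁ (b∈X , ≺⇒≢′ i≺b))) (self∉targetX (liftChoice i∉Y c) i∉Y)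
      ; N₂-admissible = record
          { matching = matching adm₂″
          ; head∈ = targetY-lift⁺ i∉Y b∈Y c ∘ head∈ adm₂″
          ; tail∉ = λ e → targetY-lift⁻ i∉Y c (tail∉ adm₂″ e) λ { refl → i∉∂N₂″ (tail∈∂ e) } }
      ; weight≤ = +-rebalance-≤ {x = 0} {w₁ b i} {w₁ b i} {0} (sym (+-identityʳ (weight M₁)))
                    (weight-clearRow m₂ b→i) weight≤″ (Attachment.weight≤ A)
                    (≤-reflexive (+-identityʳ (weight N₂″))) (≤-reflexive (+-comm 0 (w₁ b i)))
      ; ∂N⊆∂M = [ attachment-∂-elim A (old ∘ inj₁) (inj₂ (head∈∂ b→i)) (inj₂ (tail∈∂ b→i)) , old ∘ inj₂ ]′ }
      where
      open Exchange r renaming (choice to c; N₁ to N₁″; N₂ to N₂″; N₁-admissible to adm₁″;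
                                N₂-admissible to adm₂″; weight≤ to weight≤″; ∂N⊆∂M to ∂N⊆∂M″)
      i≺b : i ≺ b
      i≺b = edge-≺ m₂ b→i
      b∈Y : b ∈ Y
      b∈Y = head∈ adm₂ b→i
      i∉∂M₁ : ¬ i ∈∂ M₁
      i∉∂M₁ = ∉∂-childless adm₁ i∈X childless
      i∉∂M₂° : ¬ i ∈∂ clearRow M₂ b
      i∉∂M₂° = tail∉∂-clearRow adm₂ b→i
      i∉∂N₂″ : ¬ i ∈∂ N₂″
      i∉∂N₂″ = ∉∂N₂ r i∉∂M₁ i∉∂M₂°
      A : Attachment N₁″ b i
      A = attach (matching adm₁″) i≺b (∉∂N₁ r i∉∂M₁ i∉∂M₂°)
                 (λ s e → self∉targetX c (x∉p-x Y) (head∈ adm₁″ e))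
      old : ∀ {x} → x ∈∂ N₁″ ⊎ x ∈∂ N₂″ → x ∈∂ M₁ ⊎ x ∈∂ M₂
      old = map₂ ∂-clearRow ∘ ∂N⊆∂M″

    shortcut : ∀ {a c} → Edge M₁ i a → Edge M₂ a c → Exchange X Y i M₁ M₂
    shortcut {a} {c} i→a a→c = record
      { choice = remove ; N₁ = clearRow M₁ i ; N₂ = N A
      ; N₁-admissible = clearRow-admissible adm₁
      ; N₂-admissible = attachment-admissible A
          (λ e → ∈targetY⁺ (remove {X}) (inj₁ (head∈ adm₂ (proj₂ (Edge-clearRow⁻ e)))) λ ())
          (λ e s≢i → ∉targetY (remove {X}) (tail∉ adm₂ (proj₂ (Edge-clearRow⁻ e))) s≢i)
          (∈targetY⁺ (remove {X}) (inj₂ refl) λ ()) (∉targetY (remove {X}) (tail∉ adm₂ a→c) (≺⇒≢ c≺i))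
      ; weight≤ = +-rebalance-≤ {x = w₁ i a} {w₁ a c} {0} {w₁ i c} (weight-clearRow m₁ i→a)
                    (weight-clearRow m₂ a→c) ≤-refl (≤-reflexive (+-identityʳ (weight (clearRow M₁ i))))
                    (Attachment.weight≤ A) (w₁-superadditive (proj₁ c≺a) (proj₁ a≺i))
      ; ∂N⊆∂M = [ inj₁ ∘ ∂-clearRow
                , attachment-∂-elim A (inj₂ ∘ ∂-clearRow) (inj₁ (head∈∂ i→a)) (inj₂ (tail∈∂ a→c)) ]′ }
      where
      a≺i : a ≺ i
      a≺i = edge-≺ m₁ i→a
      c≺a : c ≺ a
      c≺a = edge-≺ m₂ a→c
      c≺i : c ≺ i
      c≺i = ≺-trans c≺a a≺i
      A : Attachment (clearRow M₂ a) i c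
      A = attach (clearRow-matching m₂) c≺i (tail∉∂-clearRow adm₂ a→c)
                 (λ s e → i∉Y (head∈ adm₂ (proj₂ (Edge-clearRow⁻ e))))

    childFree : ∀ {a} → Edge M₁ i a → ¬ a ∈∂ M₂ → (c : Choice X Y) →
                (∀ {x} → Swapped c x → x ≡ a) → a ∉ targetY c i → Exchange X Y i M₁ M₂
    childFree {a} i→a a∉∂M₂ c only-a a∉targetY = record
      { choice = c ; N₁ = clearRow M₁ i ; N₂ = N A
      ; N₁-admissible = record
          { matching = clearRow-matching m₁
          ; head∈ = λ e → let h≢i , e′ = Edge-clearRow⁻ e in ∈targetX⁺ c (inj₁ (head∈ adm₁ e′ , h≢i))
          ; tail∉ = λ e → let h≢i , e′ = Edge-clearRow⁻ e in ∉targetX c (inj₁ (tail∉ adm₁ e′))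
                            λ swapped → h≢i (uniqueHead m₁ (subst (Edge M₁ _) (only-a swapped) e′) i→a) }
      ; N₂-admissible = attachment-admissible A
          (λ e → ∈targetY⁺ c (inj₁ (head∈ adm₂ e))
                   λ swapped → a∉∂M₂ (subst (_∈∂ M₂) (only-a swapped) (head∈∂ e)))
          (λ e s≢i → ∉targetY c (tail∉ adm₂ e) s≢i)
          (∈targetY⁺ c (inj₂ refl) λ swapped → ≺⇒≢′ a≺i (only-a swapped)) a∉targetY
      ; weight≤ = +-rebalance-≤ {x = w₁ i a} {0} {0} {w₁ i a} (weight-clearRow m₁ i→a)
                    (sym (+-identityʳ (weight M₂))) ≤-refl
                    (≤-reflexive (+-identityʳ (weight (clearRow M₁ i))))
                    (Attachment.weight≤ A) (≤-reflexive (+-comm (w₁ i a) 0))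
      ; ∂N⊆∂M = [ inj₁ ∘ ∂-clearRow , attachment-∂-elim A inj₂ (inj₁ (head∈∂ i→a)) (inj₁ (tail∈∂ i→a)) ]′ }
      where
      a≺i : a ≺ i
      a≺i = edge-≺ m₁ i→a
      A : Attachment M₂ i a
      A = attach m₂ a≺i a∉∂M₂ (λ s e → i∉Y (head∈ adm₂ e))

    coparentOutside : ∀ {a b} → Edge M₁ i a → Edge M₂ b a → b ∉ X → Exchange X Y i M₁ M₂
    coparentOutside {a} {b} i→a b→a b∉X = record
      { choice = c ; N₁ = N A₁ ; N₂ = N A₂
      ; N₁-admissible = attachment-admissible A₁
          (λ e → let h≢i , e′ = Edge-clearRow⁻ e in ∈targetX⁺ c (inj₁ (head∈ adm₁ e′ , h≢i)))
          (λ e s≢b → ∉targetX c (inj₁ (tail∉ adm₁ (proj₂ (Edge-clearRow⁻ e)))) s≢b)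
          (∈targetX⁺ c (inj₂ refl)) (∉targetX c (inj₁ (tail∉ adm₁ i→a)) (≺⇒≢ a≺b))
      ; N₂-admissible = attachment-admissible A₂
          (λ e → let h≢b , e′ = Edge-clearRow⁻ e in ∈targetY⁺ c (inj₁ (head∈ adm₂ e′)) h≢b)
          (λ e s≢i → ∉targetY c (tail∉ adm₂ (proj₂ (Edge-clearRow⁻ e))) s≢i)
          (∈targetY⁺ c (inj₂ refl) λ { refl → i∉Y b∈Y }) (∉targetY c (tail∉ adm₂ b→a) (≺⇒≢ a≺i))
      ; weight≤ = +-rebalance-≤ {x = w₁ i a} {w₁ b a} {w₁ b a} {w₁ i a} (weight-clearRow m₁ i→a)
                    (weight-clearRow m₂ b→a) ≤-refl (Attachment.weight≤ A₁) (Attachment.weight≤ A₂)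
                    (≤-reflexive (+-comm (w₁ i a) (w₁ b a)))
      ; ∂N⊆∂M = [ attachment-∂-elim A₁ (inj₁ ∘ ∂-clearRow) (inj₂ (head∈∂ b→a)) (inj₁ (tail∈∂ i→a))
                , attachment-∂-elim A₂ (inj₂ ∘ ∂-clearRow) (inj₁ (head∈∂ i→a)) (inj₁ (tail∈∂ i→a)) ]′ }
      where
      b∈Y : b ∈ Y
      b∈Y = head∈ adm₂ b→a
      c : Choice X Y
      c = swap b b∈Y b∉X
      a≺i : a ≺ i
      a≺i = edge-≺ m₁ i→a
      a≺b : a ≺ b
      a≺b = edge-≺ m₂ b→a
      A₁ : Attachment (clearRow M₁ i) b a
      A₁ = attach (clearRow-matching m₁) a≺b (tail∉∂-clearRow adm₁ i→a)
                  (λ s e → b∉X (head∈ adm₁ (proj₂ (Edge-clearRow⁻ e))))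
      A₂ : Attachment (clearRow M₂ b) i a
      A₂ = attach (clearRow-matching m₂) a≺i (tail∉∂-clearRow adm₂ b→a)
                  (λ s e → i∉Y (head∈ adm₂ (proj₂ (Edge-clearRow⁻ e))))

    coparentInside : ∀ {a b} → Edge M₁ i a → Edge M₂ b a → b ∈ X →
                     Exchange (X - i) (Y - b) b (clearRow M₁ i) (clearRow M₂ b) → Exchange X Y i M₁ M₂
    coparentInside {a} {b} i→a b→a b∈X r = record
      { choice = c′ ; N₁ = N A₁ ; N₂ = N A₂
      ; N₁-admissible = attachment-admissible A₁
          (targetX-lift⁺ i∉Y c ∘ head∈ adm₁″) (λ e s≢b → targetX-lift⁻ i∉Y c (tail∉ adm₁″ e) s≢b)
          (∈targetX⁺ c′ (inj₁ (b∈X , λ { refl → i∉Y b∈Y })))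
          (∉targetX c′ (inj₁ (tail∉ adm₁ i→a)) (tail∉ adm₂ b→a ∘ swapped∈Y c′))
      ; N₂-admissible = attachment-admissible A₂
          (targetY-lift⁺ i∉Y b∈Y c ∘ head∈ adm₂″) (λ e s≢i → targetY-lift⁻ i∉Y c (tail∉ adm₂″ e) s≢i)
          (∈targetY⁺ c′ (inj₂ refl) (i∉Y ∘ swapped∈Y c′)) (∉targetY c′ (tail∉ adm₂ b→a) (≺⇒≢ a≺i))
      ; weight≤ = +-rebalance-≤ {x = w₁ i a} {w₁ b a} {w₁ b a} {w₁ i a} (weight-clearRow m₁ i→a)
                    (weight-clearRow m₂ b→a) weight≤″ (Attachment.weight≤ A₁) (Attachment.weight≤ A₂)
                    (≤-reflexive (+-comm (w₁ i a) (w₁ b a)))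
      ; ∂N⊆∂M = [ attachment-∂-elim A₁ (old ∘ inj₁) (inj₂ (head∈∂ b→a)) (inj₁ (tail∈∂ i→a))
                , attachment-∂-elim A₂ (old ∘ inj₂) (inj₁ (head∈∂ i→a)) (inj₁ (tail∈∂ i→a)) ]′ }
      where
      open Exchange r renaming (choice to c; N₁ to N₁″; N₂ to N₂″; N₁-admissible to adm₁″;
                                N₂-admissible to adm₂″; weight≤ to weight≤″; ∂N⊆∂M to ∂N⊆∂M″)
      c′ : Choice X Y
      c′ = liftChoice i∉Y c
      b∈Y : b ∈ Y
      b∈Y = head∈ adm₂ b→a
      a≺i : a ≺ i
      a≺i = edge-≺ m₁ i→a
      a≺b : a ≺ b
      a≺b = edge-≺ m₂ b→a
      a∉∂M₁° : ¬ a ∈∂ clearRow M₁ i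
      a∉∂M₁° = tail∉∂-clearRow adm₁ i→a
      a∉∂M₂° : ¬ a ∈∂ clearRow M₂ b
      a∉∂M₂° = tail∉∂-clearRow adm₂ b→a
      A₁ : Attachment N₁″ b a
      A₁ = attach (matching adm₁″) a≺b (∉∂N₁ r a∉∂M₁° a∉∂M₂°)
                  (λ s e → self∉targetX c (x∉p-x Y) (head∈ adm₁″ e))
      A₂ : Attachment N₂″ i a
      A₂ = attach (matching adm₂″) a≺i (∉∂N₂ r a∉∂M₁° a∉∂M₂°)
                  (λ s e → ∉targetY c (i∉Y ∘ proj₁ ∘ x∈p-y⁻ Y) (λ { refl → i∉Y b∈Y }) (head∈ adm₂″ e))
      old : ∀ {x} → x ∈∂ N₁″ ⊎ x ∈∂ N₂″ → x ∈∂ M₁ ⊎ x ∈∂ M₂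
      old = ⊎-map ∂-clearRow ∂-clearRow ∘ ∂N⊆∂M″

    exchange-step : (∀ {b M₁° M₂°} → IsAdmissible (X - i) M₁° → IsAdmissible (Y - b) M₂° → b ∈ X - i →
                       b ∉ Y - b → Exchange (X - i) (Y - b) b M₁° M₂°) →
                    Exchange X Y i M₁ M₂
    exchange-step recurse with child? M₁ i
    ... | no no-child with parent? M₂ i
    ...   | no no-parent = isolated (curry no-child) (curry no-parent)
    ...   | yes (b , b→i) with b ∈? X
    ...     | no b∉X  = parentOutside (curry no-child) b→i b∉X
    ...     | yes b∈X = parentInside (curry no-child) b→i b∈X
                          (recurse (childless-admissible adm₁ (curry no-child)) (clearRow-admissible adm₂)
                                   (x∈p∧x≢y⇒x∈p-y b∈X (≺⇒≢′ (edge-≺ m₂ b→i))) (x∉p-x Y))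
    exchange-step recurse | yes (a , i→a) with parent? M₂ a | child? M₂ a
    ... | yes (b , b→a) | _ with b ∈? X
    ...   | no b∉X  = coparentOutside i→a b→a b∉X
    ...   | yes b∈X = coparentInside i→a b→a b∈X
                        (recurse (clearRow-admissible adm₁) (clearRow-admissible adm₂)
                                 (x∈p∧x≢y⇒x∈p-y b∈X λ { refl → i∉Y (head∈ adm₂ b→a) }) (x∉p-x Y))
    exchange-step recurse | yes (a , i→a) | no _ | yes (c , a→c) = shortcut i→a a→c
    exchange-step recurse | yes (a , i→a) | no no-parent | no no-child with a ∈? Y
    ... | yes a∈Y = childFree i→a (∉∂⁺ no-parent no-child) c (λ x≡a → x≡a) (swapped∉targetY c refl)
      where
      c : Choice X Y
      c = swap a a∈Y (tail∉ adm₁ i→a)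
    ... | no a∉Y  = childFree i→a (∉∂⁺ no-parent no-child) remove (λ ())
                      (∉targetY (remove {X}) a∉Y (≺⇒≢ (edge-≺ m₁ i→a)))

  exchange : ∀ k {X Y i M₁ M₂} → ∣ X ∣ < k → IsAdmissible X M₁ → IsAdmissible Y M₂ → i ∈ X → i ∉ Y →
             Exchange X Y i M₁ M₂
  exchange (suc k) |X|<k adm₁ adm₂ i∈X i∉Y = ExchangeCases.exchange-step adm₁ adm₂ i∈X i∉Y
    (exchange k (<-≤-trans (x∈p⇒∣p-x∣<∣p∣ i∈X) (≤-pred |X|<k)))

  -- Values of f₁

  ∈-allEdgeSets : ∀ M → M ∈ₗ allEdgeSets
  ∈-allEdgeSets M = ∈-vecsOf (allSubsets n) ∈-allSubsets n M

  f₁-upperBound : ∀ {X M} → IsAdmissible X M → weight M ≤ f₁ X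
  f₁-upperBound {X} {M} adm =
    maxOver-upperBound _ weight (∈-filter⁺ (admissible? X) (∈-allEdgeSets M) (toAdmissible adm))

  f₁-attained : ∀ X → ∃[ M ] (IsAdmissible X M × f₁ X ≡ weight M)
  f₁-attained X
    with maxOver-attained _ weight
           (∈-filter⁺ (admissible? X) (∈-allEdgeSets noEdges) (toAdmissible noEdges-admissible))
  ... | M , M∈ , f₁X≡ = M , fromAdmissible M (proj₂ (∈-filter⁻ (admissible? X) {xs = allEdgeSets} M∈)) , f₁X≡

  exchange⇒f₁-bound : ∀ {X Y i M₁ M₂} (r : Exchange X Y i M₁ M₂) → f₁ X ≡ weight M₁ → f₁ Y ≡ weight M₂ →
    f₁ X + f₁ Y ≤ f₁ (targetX (Exchange.choice r) i) + f₁ (targetY (Exchange.choice r) i)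
  exchange⇒f₁-bound {X} {Y} {M₁ = M₁} {M₂} r f₁X≡ f₁Y≡ = begin
    f₁ X + f₁ Y                ≡⟨ cong₂ _+_ f₁X≡ f₁Y≡ ⟩
    weight M₁ + weight M₂      ≤⟨ weight≤ ⟩
    weight N₁ + weight N₂      ≤⟨ +-mono-≤ (f₁-upperBound N₁-admissible) (f₁-upperBound N₂-admissible) ⟩
    _                          ∎
    where
    open Exchange r
    open ≤-Reasoning

  f₁-M♮-concave : MNatConcave f₁
  f₁-M♮-concave X Y i i∈X i∉Y with f₁-attained X | f₁-attained Y
  ... | M₁ , adm₁ , f₁X≡ | M₂ , adm₂ , f₁Y≡
    with exchange (suc ∣ X ∣) ≤-refl adm₁ adm₂ i∈X i∉Y
  ... | r with Exchange.choice r | exchange⇒f₁-bound r f₁X≡ f₁Y≡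
  ...   | remove         | bound = inj₁ bound
  ...   | swap j j∈Y j∉X | bound = inj₂ (j , j∈Y , j∉X , bound)

  ideal⇒f₁≡0 : ∀ X → IsIdeal X → f₁ X ≡ 0
  ideal⇒f₁≡0 X ideal with f₁-attained X
  ... | M , adm , f₁X≡ = trans f₁X≡ (weight-edgeless λ h t e →
    tail∉ adm e (ideal t h (proj₁ (edge-≺ (matching adm) e)) (head∈ adm e)))

  nonIdeal-witness : ∀ X → ¬ IsIdeal X → ∃[ x ] ∃[ y ] (x ≼ y × y ∈ X × x ∉ X)
  nonIdeal-witness X not-ideal
    with ¬∀⟶∃¬ n _ (λ x → all? λ y → (x ≼? y) →-dec ((y ∈? X) →-dec (x ∈? X))) not-ideal
  ... | x , x-escapes with ¬∀⟶∃¬ n _ (λ y → (x ≼? y) →-dec ((y ∈? X) →-dec (x ∈? X))) x-escapes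
  ... | y , ¬closed =
    x , y , decidable-stable (x ≼? y) (λ x⋠y → ¬closed (⊥-elim ∘ x⋠y)) ,
    decidable-stable (y ∈? X) (λ y∉X → ¬closed λ _ → ⊥-elim ∘ y∉X) , λ x∈X → ¬closed λ _ _ → x∈X

  nonIdeal⇒0<f₁ : ∀ X → ¬ IsIdeal X → 0 < f₁ X
  nonIdeal⇒0<f₁ X not-ideal with nonIdeal-witness X not-ideal
  ... | x , y , x≼y , y∈X , x∉X = begin-strict
    0                        <⟨ w₁-positive x≺y ⟩
    w₁ y x                   ≤⟨ m≤n+m (w₁ y x) (weight noEdges) ⟩
    weight noEdges + w₁ y x  ≤⟨ Attachment.weight≤ A ⟩
    weight (Attachment.N A)  ≤⟨ f₁-upperBound (attachment-admissible A (⊥-elim ∘ ¬Edge-noEdges)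
                                                  (λ e → ⊥-elim (¬Edge-noEdges e)) y∈X x∉X) ⟩
    f₁ X                     ∎
    where
    open ≤-Reasoning
    x≺y : x ≺ y
    x≺y = x≼y , λ { refl → x∉X y∈X }
    A : Attachment noEdges y x
    A = attach noEdges-matching x≺y (λ { (_ , inj₁ e) → ¬Edge-noEdges e ; (_ , inj₂ e) → ¬Edge-noEdges e })
               (λ _ → ¬Edge-noEdges)

lemma7 : (n : ℕ) (_≼_ : Rel (Fin n) 0ℓ) (P : IsDecPartialOrder _≡_ _≼_) →
    let open PosetDefs _≼_ (IsDecPartialOrder._≤?_ P) in
    MNatConcave f₁ × (∀ (X : Subset n) → (IsIdeal X → f₁ X ≡ 0) × (¬ IsIdeal X → 0 < f₁ X))
lemma7 n _≼_ P = f₁-M♮-concave , λ X → ideal⇒f₁≡0 X , nonIdeal⇒0<f₁ X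
  where open PosetMatchings _≼_ P
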